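{- Let $G=(V,E)$ be a connected graph and let $M$ be a module of $G$ with $\emptyset\ne M\ne V$. Let $D$ be a minimum dominating set of $G$. Then $M\cap D$ is either $\emptyset$, a single vertex $\{v\}$, or a minimum dominating set of $G[M]$.
   Context: A module of $G=(V,E)$ is a set $M\subseteq V$ such that every $v\in V\setminus M$ is adjacent to all or to none of $M$. A dominating set of $G$ is a set $D\subseteq V$ such that every vertex not in $D$ is adjacent to some vertex of $D$; it is minimum if it has minimum cardinality. -}

module Defs where

open import Data.Nat using (ℕ; _≤_)
open import Data.Fin using (Fin)
open import Data.Fin.Subset using (Subset; _∈_; _∉_; _⊆_; ∣_∣)
open import Data.Product using (Σ; ∃; _×_; _,_)
open import Data.Sum using (_⊎_)
open import Relation.Nullary using (¬_)
open import Relation.Binary.PropositionalEquality using (_≡_)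
open import Level using (0ℓ)

record Graph (n : ℕ) : Set₁ where
  field
    Adj       : Fin n → Fin n → Set
    sym       : ∀ {u v} → Adj u v → Adj v u
    irrefl    : ∀ {v} → ¬ Adj v v

open Graph public

data Walk {n : ℕ} (G : Graph n) : Fin n → Fin n → Set where
  here : ∀ {v} → Walk G v v
  step : ∀ {u w v} → Adj G u w → Walk G w v → Walk G u v

Connected : ∀ {n} → Graph n → Set
Connected {n} G = ∀ (u v : Fin n) → Walk G u v

IsModule : ∀ {n} → Graph n → Subset n → Set
IsModule {n} G M =
  ∀ (v : Fin n) → v ∉ M →
    (∀ u → u ∈ M → Adj G v u) ⊎ (∀ u → u ∈ M → ¬ Adj G v u)

-- With X = ⊤ this is a dominating set of G; in general a dominating set of G[X].
DominatesIn : ∀ {n} → Graph n → Subset n → Subset n → Set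
DominatesIn {n} G X D =
  D ⊆ X × (∀ (v : Fin n) → v ∈ X → v ∉ D → ∃ λ u → u ∈ D × Adj G v u)

MinDominatingIn : ∀ {n} → Graph n → Subset n → Subset n → Set
MinDominatingIn {n} G X D =
  DominatesIn G X D × (∀ (D' : Subset n) → DominatesIn G X D' → ∣ D ∣ ≤ ∣ D' ∣)

-- For X meeting M, replace D's part inside M by X's part:
-- E = (M ∩ X) ∪ (D ─ M). A vertex outside M that D dominates from inside M
-- is, M being a module, adjacent to all of M and hence to E ∩ M; so E
-- dominates G as soon as it dominates M, and then minimality of D gives
-- ∣ M ∩ D ∣ ≤ ∣ M ∩ X ∣. Taking for X a dominating set of G[M] shows that
-- M ∩ D is no larger than any such set. If ∣ M ∩ D ∣ ≥ 2 and some v ∈ M were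
-- dominated by D only from outside M, its dominator would see all of M, so
-- X = ⁅ v ⁆ would already do, contradicting ∣ M ∩ D ∣ ≤ 1; hence M ∩ D
-- dominates G[M].
module Submission where

open import Defs
open import Data.Nat using (ℕ; suc; _+_; _≤_; s≤s; z≤n)
open import Data.Nat.Properties
  using (≤-trans; ≤-reflexive; <⇒≱; +-suc; +-assoc; +-comm; +-cancelʳ-≤; n≤1+n; +-monoˡ-≤; +-monoʳ-≤;
         module ≤-Reasoning)
open import Data.Fin using (Fin; zero; suc)
open import Data.Fin.Subset
  using (Subset; ⊤; ⊥; ⁅_⁆; _∩_; _∪_; _─_; Nonempty; _∈_; _∉_; ∣_∣; inside; outside)
open import Data.Fin.Subset.Properties
  using (_∈?_; x∈p∩q⁺; p∩q⊆p; ∣p∩q∣≤∣q∣; ∣⁅x⁆∣≡1; x∈⁅x⁆; ∈⊤; x∈p∪q⁺; x∈p∧x∉q⇒x∈p─q)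
open import Data.Vec using ([]; _∷_)
open import Data.Product using (∃; _×_; _,_)
open import Data.Sum using (_⊎_; inj₁; inj₂)
open import Data.Empty using (⊥-elim)
open import Relation.Nullary using (¬_; yes; no)
open import Relation.Binary.PropositionalEquality
  using (_≡_; refl; cong; subst; trans) renaming (sym to ≡-sym)

∣p∪q∣≤∣p∣+∣q∣ : ∀ {n} (p q : Subset n) → ∣ p ∪ q ∣ ≤ ∣ p ∣ + ∣ q ∣
∣p∪q∣≤∣p∣+∣q∣ []            []            = z≤n
∣p∪q∣≤∣p∣+∣q∣ (outside ∷ p) (outside ∷ q) = ∣p∪q∣≤∣p∣+∣q∣ p q
∣p∪q∣≤∣p∣+∣q∣ (outside ∷ p) (inside  ∷ q) =
  subst (suc ∣ p ∪ q ∣ ≤_) (≡-sym (+-suc ∣ p ∣ ∣ q ∣)) (s≤s (∣p∪q∣≤∣p∣+∣q∣ p q))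
∣p∪q∣≤∣p∣+∣q∣ (inside  ∷ p) (outside ∷ q) = s≤s (∣p∪q∣≤∣p∣+∣q∣ p q)
∣p∪q∣≤∣p∣+∣q∣ (inside  ∷ p) (inside  ∷ q) =
  s≤s (≤-trans (∣p∪q∣≤∣p∣+∣q∣ p q) (+-monoʳ-≤ ∣ p ∣ (n≤1+n ∣ q ∣)))

∣p─q∣+∣q∩p∣≡∣p∣ : ∀ {n} (p q : Subset n) → ∣ p ─ q ∣ + ∣ q ∩ p ∣ ≡ ∣ p ∣
∣p─q∣+∣q∩p∣≡∣p∣ []            []            = refl
∣p─q∣+∣q∩p∣≡∣p∣ (outside ∷ p) (outside ∷ q) = ∣p─q∣+∣q∩p∣≡∣p∣ p q
∣p─q∣+∣q∩p∣≡∣p∣ (inside  ∷ p) (outside ∷ q) = cong suc (∣p─q∣+∣q∩p∣≡∣p∣ p q)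
∣p─q∣+∣q∩p∣≡∣p∣ (outside ∷ p) (inside  ∷ q) = ∣p─q∣+∣q∩p∣≡∣p∣ p q
∣p─q∣+∣q∩p∣≡∣p∣ (inside  ∷ p) (inside  ∷ q) =
  trans (+-suc ∣ p ─ q ∣ ∣ q ∩ p ∣) (cong suc (∣p─q∣+∣q∩p∣≡∣p∣ p q))

p≡⊥⊎p≡⁅x⁆⊎2≤∣p∣ : ∀ {n} (p : Subset n) → p ≡ ⊥ ⊎ (∃ λ x → p ≡ ⁅ x ⁆) ⊎ 2 ≤ ∣ p ∣
p≡⊥⊎p≡⁅x⁆⊎2≤∣p∣ [] = inj₁ refl
p≡⊥⊎p≡⁅x⁆⊎2≤∣p∣ (outside ∷ p) with p≡⊥⊎p≡⁅x⁆⊎2≤∣p∣ p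
... | inj₁ p≡⊥              = inj₁ (cong (outside ∷_) p≡⊥)
... | inj₂ (inj₁ (x , p≡x)) = inj₂ (inj₁ (suc x , cong (outside ∷_) p≡x))
... | inj₂ (inj₂ 2≤∣p∣)     = inj₂ (inj₂ 2≤∣p∣)
p≡⊥⊎p≡⁅x⁆⊎2≤∣p∣ (inside ∷ p) with p≡⊥⊎p≡⁅x⁆⊎2≤∣p∣ p
... | inj₁ p≡⊥              = inj₂ (inj₁ (zero , cong (inside ∷_) p≡⊥))
... | inj₂ (inj₁ (x , refl)) = inj₂ (inj₂ (s≤s (≤-reflexive (≡-sym (∣⁅x⁆∣≡1 x)))))
... | inj₂ (inj₂ 2≤∣p∣)     = inj₂ (inj₂ (≤-trans 2≤∣p∣ (n≤1+n ∣ p ∣)))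

exchange : ∀ {n} → Subset n → Subset n → Subset n → Subset n
exchange M A X = (M ∩ X) ∪ (A ─ M)

module _ {n} {M A X : Subset n} where

  ∈-exchange-inside : ∀ {v} → v ∈ M → v ∈ X → v ∈ exchange M A X
  ∈-exchange-inside v∈M v∈X = x∈p∪q⁺ (inj₁ (x∈p∩q⁺ (v∈M , v∈X)))

  ∈-exchange-outside : ∀ {v} → v ∉ M → v ∈ A → v ∈ exchange M A X
  ∈-exchange-outside v∉M v∈A = x∈p∪q⁺ (inj₂ (x∈p∧x∉q⇒x∈p─q v∈A v∉M))

∣exchange∣+∣M∩A∣≤∣M∩X∣+∣A∣ : ∀ {n} (M A X : Subset n) →
  ∣ exchange M A X ∣ + ∣ M ∩ A ∣ ≤ ∣ M ∩ X ∣ + ∣ A ∣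
∣exchange∣+∣M∩A∣≤∣M∩X∣+∣A∣ M A X = begin
  ∣ (M ∩ X) ∪ (A ─ M) ∣ + ∣ M ∩ A ∣    ≤⟨ +-monoˡ-≤ ∣ M ∩ A ∣ (∣p∪q∣≤∣p∣+∣q∣ (M ∩ X) (A ─ M)) ⟩
  ∣ M ∩ X ∣ + ∣ A ─ M ∣ + ∣ M ∩ A ∣    ≡⟨ +-assoc (∣ M ∩ X ∣) (∣ A ─ M ∣) (∣ M ∩ A ∣) ⟩
  ∣ M ∩ X ∣ + (∣ A ─ M ∣ + ∣ M ∩ A ∣)  ≡⟨ cong (∣ M ∩ X ∣ +_) (∣p─q∣+∣q∩p∣≡∣p∣ A M) ⟩
  ∣ M ∩ X ∣ + ∣ A ∣                    ∎
  where open ≤-Reasoning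

module _ {n} (G : Graph n) where

  dominates-nonempty : ∀ {X D : Subset n} → DominatesIn G X D → Nonempty X → Nonempty D
  dominates-nonempty {D = D} (_ , D-dom) (x , x∈X) with x ∈? D
  ... | yes x∈D = x , x∈D
  ... | no x∉D with D-dom x x∈X x∉D
  ... | u , u∈D , _ = u , u∈D

  exchange-bound : ∀ {M D X : Subset n} → MinDominatingIn G ⊤ D →
    DominatesIn G ⊤ (exchange M D X) → ∣ M ∩ D ∣ ≤ ∣ M ∩ X ∣
  exchange-bound {M} {D} {X} (_ , D-min) E-dom = +-cancelʳ-≤ ∣ D ∣ _ _ (begin
    ∣ M ∩ D ∣ + ∣ D ∣                ≤⟨ +-monoʳ-≤ ∣ M ∩ D ∣ (D-min _ E-dom) ⟩
    ∣ M ∩ D ∣ + ∣ exchange M D X ∣   ≡⟨ +-comm (∣ M ∩ D ∣) (∣ exchange M D X ∣) ⟩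
    ∣ exchange M D X ∣ + ∣ M ∩ D ∣   ≤⟨ ∣exchange∣+∣M∩A∣≤∣M∩X∣+∣A∣ M D X ⟩
    ∣ M ∩ X ∣ + ∣ D ∣                ∎)
    where open ≤-Reasoning

  module _ {M : Subset n} (isModule : IsModule G M) where

    adj-one⇒adj-all : ∀ {v u} → v ∉ M → u ∈ M → Adj G v u → ∀ w → w ∈ M → Adj G v w
    adj-one⇒adj-all v∉M u∈M v~u with isModule _ v∉M
    ... | inj₁ v~M = v~M
    ... | inj₂ v≁M = ⊥-elim (v≁M _ u∈M v~u)

    exchange-dominates : ∀ {D X : Subset n} {x} → DominatesIn G ⊤ D → x ∈ M → x ∈ X →
      (∀ v → v ∈ M → v ∉ exchange M D X → ∃ λ u → u ∈ exchange M D X × Adj G v u) →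
      DominatesIn G ⊤ (exchange M D X)
    exchange-dominates {D} {X} {x} (_ , D-dom) x∈M x∈X dominates-M = (λ _ → ∈⊤) , dom
      where
        dom : ∀ v → v ∈ ⊤ → v ∉ exchange M D X → ∃ λ u → u ∈ exchange M D X × Adj G v u
        dom v _ v∉E with v ∈? M
        ... | yes v∈M = dominates-M v v∈M v∉E
        ... | no v∉M with D-dom v ∈⊤ (λ v∈D → v∉E (∈-exchange-outside v∉M v∈D))
        ... | u , u∈D , v~u with u ∈? M
        ... | no u∉M  = u , ∈-exchange-outside u∉M u∈D , v~u
        ... | yes u∈M = x , ∈-exchange-inside x∈M x∈X , adj-one⇒adj-all v∉M u∈M v~u x x∈M

    M∩D-dominates-M : ∀ {D} → MinDominatingIn G ⊤ D → 2 ≤ ∣ M ∩ D ∣ → DominatesIn G M (M ∩ D)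
    M∩D-dominates-M {D} D-min@(D-dominates@(_ , D-dom) , _) 2≤∣M∩D∣ = p∩q⊆p M D , dom
      where
        dom : ∀ v → v ∈ M → v ∉ M ∩ D → ∃ λ u → u ∈ M ∩ D × Adj G v u
        dom v v∈M v∉M∩D with D-dom v ∈⊤ (λ v∈D → v∉M∩D (x∈p∩q⁺ (v∈M , v∈D)))
        ... | u , u∈D , v~u with u ∈? M
        ... | yes u∈M = u , x∈p∩q⁺ (u∈M , u∈D) , v~u
        ... | no u∉M  = ⊥-elim (<⇒≱ 2≤∣M∩D∣ (begin
          ∣ M ∩ D ∣       ≤⟨ exchange-bound D-min E-dom ⟩
          ∣ M ∩ ⁅ v ⁆ ∣   ≤⟨ ∣p∩q∣≤∣q∣ M ⁅ v ⁆ ⟩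
          ∣ ⁅ v ⁆ ∣       ≡⟨ ∣⁅x⁆∣≡1 v ⟩
          1               ∎))
          where
            open ≤-Reasoning
            u~M : ∀ w → w ∈ M → Adj G u w
            u~M = adj-one⇒adj-all u∉M v∈M (sym G v~u)
            E-dom : DominatesIn G ⊤ (exchange M D ⁅ v ⁆)
            E-dom = exchange-dominates D-dominates v∈M (x∈⁅x⁆ v)
              λ w w∈M _ → u , ∈-exchange-outside u∉M u∈D , sym G (u~M w w∈M)

    M∩D-minimum : ∀ {D} → MinDominatingIn G ⊤ D → Nonempty M →
      ∀ D' → DominatesIn G M D' → ∣ M ∩ D ∣ ≤ ∣ D' ∣
    M∩D-minimum {D} D-min@(D-dominates , _) M-nonempty D' D'-dom@(D'⊆M , D'-dominates) =
      ≤-trans (exchange-bound D-min E-dom) (∣p∩q∣≤∣q∣ M D')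
      where
        dominates-M : ∀ v → v ∈ M → v ∉ exchange M D D' → ∃ λ u → u ∈ exchange M D D' × Adj G v u
        dominates-M v v∈M v∉E with v ∈? D'
        ... | yes v∈D' = ⊥-elim (v∉E (∈-exchange-inside v∈M v∈D'))
        ... | no v∉D' with D'-dominates v v∈M v∉D'
        ... | u , u∈D' , v~u = u , ∈-exchange-inside (D'⊆M u∈D') u∈D' , v~u
        E-dom : DominatesIn G ⊤ (exchange M D D')
        E-dom with dominates-nonempty D'-dom M-nonempty
        ... | x , x∈D' = exchange-dominates D-dominates (D'⊆M x∈D') x∈D' dominates-M

lemma4 : ∀ {n : ℕ} (G : Graph n) (M D : Subset n) →
    Connected G → IsModule G M → Nonempty M → ¬ (M ≡ ⊤) →
    MinDominatingIn G ⊤ D →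
    (M ∩ D ≡ ⊥) ⊎ (∃ λ (v : Fin n) → M ∩ D ≡ ⁅ v ⁆) ⊎ MinDominatingIn G M (M ∩ D)
lemma4 G M D _ isModule M-nonempty _ D-min with p≡⊥⊎p≡⁅x⁆⊎2≤∣p∣ (M ∩ D)
... | inj₁ M∩D≡⊥         = inj₁ M∩D≡⊥
... | inj₂ (inj₁ M∩D≡⁅v⁆) = inj₂ (inj₁ M∩D≡⁅v⁆)
... | inj₂ (inj₂ 2≤∣M∩D∣) =
  inj₂ (inj₂ (M∩D-dominates-M G isModule D-min 2≤∣M∩D∣ , M∩D-minimum G isModule D-min M-nonempty))
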